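{- Let $M$ be a complete linear lattice, $\Omega$ a nonempty set and $\mathcal{S}\subseteq 2^\Omega$ with $\emptyset,\Omega\in\mathcal{S}$. Every minitive measure $\mu:\mathcal{S}\to M$ is a lower chain measure. Also, every maxitive measure $\mu:\mathcal{S}\to M$ is an upper chain measure.
   Context: $M$ has bottom $\mathbb{O}$ and top $\mathbb{I}$. A measure is a map $\mu:\mathcal{S}\to M$ with $\mu(\emptyset)=\mathbb{O}$, $\mu(\Omega)=\mathbb{I}$ and $A\subseteq B\Rightarrow\mu(A)\le\mu(B)$. For a family $\mathcal{T}\subseteq 2^\Omega$ and $\nu:\mathcal{T}\to M$, the inner extension is $\nu_*(A)=\bigvee_{B\in\mathcal{T},B\subseteq A}\nu(B)$ and the outer extension is $\nu^*(A)=\bigwedge_{B\in\mathcal{T},B\supseteq A}\nu(B)$, $A\subseteq\Omega$. $\mu$ is a lower (resp. upper) chain measure if there is a chain $\mathcal{K}\subseteq\mathcal{S}$ (totally ordered by inclusion) with $\emptyset,\Omega\in\mathcal{K}$ such that $\mu(A)=(\mu|_{\mathcal{K}})_*(A)$ (resp. $\mu(A)=(\mu|_{\mathcal{K}})^*(A)$) for all $A\in\mathcal{S}$. $\mu$ is minitive (a necessity measure) if $\mathcal{S}$ is closed under arbitrary intersections and $\mu(\bigcap_{A\in\mathcal{A}}A)=\bigwedge_{A\in\mathcal{A}}\mu(A)$ for every $\mathcal{A}\subseteq\mathcal{S}$; dually $\mu$ is maxitive (a possibility measure) if $\mathcal{S}$ is closed under arbitrary unions and $\mu(\bigcup_{A\in\mathcal{A}}A)=\bigvee_{A\in\mathcal{A}}\mu(A)$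 for every $\mathcal{A}\subseteq\mathcal{S}$. -}

module Defs where

open import Level using (Level; _⊔_) renaming (suc to lsuc; zero to lzero)
open import Data.Empty using (⊥)
open import Data.Unit using (⊤)
open import Data.Product using (Σ; _×_; _,_; proj₁; proj₂)
open import Data.Sum using (_⊎_)
open import Relation.Binary.PropositionalEquality using (_≡_)

-- Arbitrary joins/meets are taken over index types in Set₁, which is
-- large enough to index every family of subsets of a set Ω : Set
-- (subsets are predicates Ω → Set, families are predicates on them).

record CompleteLinearLattice : Set₂ where
  field
    Carrier   : Set
    _≤_       : Carrier → Carrier → Set
    ≤-refl    : ∀ {x} → x ≤ x
    ≤-trans   : ∀ {x y z} → x ≤ y → y ≤ z → x ≤ z
    ≤-antisym : ∀ {x y} → x ≤ y → y ≤ x → x ≡ y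
    ≤-total   : ∀ x y → x ≤ y ⊎ y ≤ x
    ⋁         : {I : Set₁} → (I → Carrier) → Carrier
    ⋁-upper   : {I : Set₁} (f : I → Carrier) (i : I) → f i ≤ ⋁ f
    ⋁-least   : {I : Set₁} (f : I → Carrier) (z : Carrier) →
                (∀ i → f i ≤ z) → ⋁ f ≤ z
    ⋀         : {I : Set₁} → (I → Carrier) → Carrier
    ⋀-lower   : {I : Set₁} (f : I → Carrier) (i : I) → ⋀ f ≤ f i
    ⋀-greatest : {I : Set₁} (f : I → Carrier) (z : Carrier) →
                 (∀ i → z ≤ f i) → z ≤ ⋀ f

  𝕆 : Carrier
  𝕆 = ⋁ {I = Level.Lift _ ⊥} (λ ())

  𝕀 : Carrier
  𝕀 = ⋀ {I = Level.Lift _ ⊥} (λ ())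

Subset : Set → Set₁
Subset Ω = Ω → Set

Family : Set → Set₁
Family Ω = Subset Ω → Set

module _ {Ω : Set} where

  ∅ : Subset Ω
  ∅ _ = ⊥

  Full : Subset Ω
  Full _ = ⊤

  _⊆_ : Subset Ω → Subset Ω → Set
  A ⊆ B = ∀ ω → A ω → B ω

  ⋂ : Family Ω → Ω → Set₁
  ⋂ 𝒜 ω = ∀ A → 𝒜 A → A ω

  ⋃ : Family Ω → Ω → Set₁
  ⋃ 𝒜 ω = Σ (Subset Ω) (λ A → 𝒜 A × A ω)

  _≐_ : Subset Ω → (Ω → Set₁) → Set₁
  C ≐ P = ∀ ω → (C ω → P ω) × (P ω → C ω)

  _⊑_ : Family Ω → Family Ω → Set₁
  𝒜 ⊑ 𝒮 = ∀ A → 𝒜 A → 𝒮 A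

module Measures (M : CompleteLinearLattice) {Ω : Set} (𝒮 : Family Ω)
                (∅∈𝒮 : 𝒮 ∅) (Ω∈𝒮 : 𝒮 Full) where
  open CompleteLinearLattice M

  MeasureFn : Set₁
  MeasureFn = (A : Subset Ω) → 𝒮 A → Carrier

  record IsMeasure (μ : MeasureFn) : Set₁ where
    field
      μ-∅    : μ ∅ ∅∈𝒮 ≡ 𝕆
      μ-Ω    : μ Full Ω∈𝒮 ≡ 𝕀
      μ-mono : ∀ A B (a : 𝒮 A) (b : 𝒮 B) → A ⊆ B → μ A a ≤ μ B b

  record IsMinitive (μ : MeasureFn) : Set₂ where
    field
      measure : IsMeasure μ
      ⋂-closed : ∀ (𝒜 : Family Ω) → 𝒜 ⊑ 𝒮 →
                 Σ (Subset Ω) (λ C → 𝒮 C × (C ≐ ⋂ 𝒜))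
      μ-⋂ : ∀ (𝒜 : Family Ω) (h : 𝒜 ⊑ 𝒮) (C : Subset Ω) (c : 𝒮 C) →
            C ≐ ⋂ 𝒜 →
            μ C c ≡ ⋀ {I = Σ (Subset Ω) 𝒜} (λ p → μ (proj₁ p) (h (proj₁ p) (proj₂ p)))

  record IsMaxitive (μ : MeasureFn) : Set₂ where
    field
      measure : IsMeasure μ
      ⋃-closed : ∀ (𝒜 : Family Ω) → 𝒜 ⊑ 𝒮 →
                 Σ (Subset Ω) (λ C → 𝒮 C × (C ≐ ⋃ 𝒜))
      μ-⋃ : ∀ (𝒜 : Family Ω) (h : 𝒜 ⊑ 𝒮) (C : Subset Ω) (c : 𝒮 C) →
            C ≐ ⋃ 𝒜 →
            μ C c ≡ ⋁ {I = Σ (Subset Ω) 𝒜} (λ p → μ (proj₁ p) (h (proj₁ p) (proj₂ p)))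

  record IsChain (𝒦 : Family Ω) (k : 𝒦 ⊑ 𝒮) : Set₁ where
    field
      ∅∈𝒦   : 𝒦 ∅
      Ω∈𝒦   : 𝒦 Full
      total : ∀ A B → 𝒦 A → 𝒦 B → A ⊆ B ⊎ B ⊆ A

  inner : (μ : MeasureFn) (𝒦 : Family Ω) (k : 𝒦 ⊑ 𝒮) → Subset Ω → Carrier
  inner μ 𝒦 k A =
    ⋁ {I = Σ (Subset Ω) (λ B → 𝒦 B × B ⊆ A)}
      (λ p → μ (proj₁ p) (k (proj₁ p) (proj₁ (proj₂ p))))

  outer : (μ : MeasureFn) (𝒦 : Family Ω) (k : 𝒦 ⊑ 𝒮) → Subset Ω → Carrier
  outer μ 𝒦 k A =
    ⋀ {I = Σ (Subset Ω) (λ B → 𝒦 B × A ⊆ B)}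
      (λ p → μ (proj₁ p) (k (proj₁ p) (proj₁ (proj₂ p))))

  record IsLowerChainMeasure (μ : MeasureFn) : Set₂ where
    field
      measure : IsMeasure μ
      𝒦       : Family Ω
      𝒦⊆𝒮     : 𝒦 ⊑ 𝒮
      chain   : IsChain 𝒦 𝒦⊆𝒮
      μ≡inner : ∀ A (a : 𝒮 A) → μ A a ≡ inner μ 𝒦 𝒦⊆𝒮 A

  record IsUpperChainMeasure (μ : MeasureFn) : Set₂ where
    field
      measure : IsMeasure μ
      𝒦       : Family Ω
      𝒦⊆𝒮     : 𝒦 ⊑ 𝒮
      chain   : IsChain 𝒦 𝒦⊆𝒮
      μ≡outer : ∀ A (a : 𝒮 A) → μ A a ≡ outer μ 𝒦 𝒦⊆𝒮 A

module Submission where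

-- For a minitive μ and a level t ∈ M let C t be the
-- intersection of all sets of 𝒮 whose measure is at least t; it lies in
-- 𝒮 by closure under intersections, μ (C t) ≥ t by minitivity, and
-- C t ⊆ A whenever μ A ≥ t.  The map t ↦ C t is monotone, and since M is
-- linearly ordered its image (together with ∅ and Ω) is a chain 𝒦.  For
-- A ∈ 𝒮 the set C (μ A) is then a member of 𝒦 inside A of measure at
-- least μ A, which forces μ A to equal the inner extension of μ|𝒦.
-- Dually, for a maxitive μ the union of all sets of measure at most t
-- gives a monotone family of sets above A, and μ is the outer extension.

open import Defs
open import Data.Product using (_×_; Σ; _,_; proj₁; proj₂)
open import Data.Sum using (_⊎_; inj₁; inj₂)
open import Data.Empty using (⊥-elim)
open import Data.Unit using (tt)
open import Relation.Binary.PropositionalEquality using (_≡_; sym; subst)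

module _ (M : CompleteLinearLattice) {Ω : Set}
         (𝒮 : Family Ω) (∅∈𝒮 : 𝒮 ∅) (Ω∈𝒮 : 𝒮 Full) where
  open CompleteLinearLattice M
  open Measures M 𝒮 ∅∈𝒮 Ω∈𝒮

  _≅_ : Subset Ω → Subset Ω → Set
  X ≅ Y = X ⊆ Y × Y ⊆ X

  -- Monotonicity plus linearity of M makes any two members comparable.
  module LevelChain (C : Carrier → Subset Ω)
                    (C-mono : ∀ {s t} → s ≤ t → C s ⊆ C t) where

    𝒦 : Family Ω
    𝒦 X = 𝒮 X × (X ⊆ ∅ ⊎ (Full ⊆ X ⊎ Σ Carrier (λ t → X ≅ C t)))

    𝒦⊆𝒮 : 𝒦 ⊑ 𝒮
    𝒦⊆𝒮 X κ = proj₁ κ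

    level∈𝒦 : ∀ t → 𝒮 (C t) → 𝒦 (C t)
    level∈𝒦 t c = c , inj₂ (inj₂ (t , (λ ω x → x) , (λ ω x → x)))

    levels-comparable : ∀ {A B s t} → A ≅ C s → B ≅ C t → A ⊆ B ⊎ B ⊆ A
    levels-comparable {s = s} {t} (A⊆Cs , _) (_ , Ct⊆B) with ≤-total s t
    ... | inj₁ s≤t = inj₁ (λ ω x → Ct⊆B ω (C-mono s≤t ω (A⊆Cs ω x)))
    levels-comparable (_ , Cs⊆A) (B⊆Ct , _) | inj₂ t≤s =
      inj₂ (λ ω x → Cs⊆A ω (C-mono t≤s ω (B⊆Ct ω x)))

    total : ∀ A B → 𝒦 A → 𝒦 B → A ⊆ B ⊎ B ⊆ A
    total A B (_ , inj₁ A⊆∅)        _ = inj₁ (λ ω x → ⊥-elim (A⊆∅ ω x))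
    total A B (_ , inj₂ (inj₁ Ω⊆A)) _ = inj₂ (λ ω _ → Ω⊆A ω tt)
    total A B _ (_ , inj₁ B⊆∅)        = inj₂ (λ ω x → ⊥-elim (B⊆∅ ω x))
    total A B _ (_ , inj₂ (inj₁ Ω⊆B)) = inj₁ (λ ω _ → Ω⊆B ω tt)
    total A B (_ , inj₂ (inj₂ (_ , A≅Cs))) (_ , inj₂ (inj₂ (_ , B≅Ct))) =
      levels-comparable A≅Cs B≅Ct

    isChain : IsChain 𝒦 𝒦⊆𝒮
    isChain = record
      { ∅∈𝒦   = ∅∈𝒮 , inj₁ (λ ω x → x)
      ; Ω∈𝒦   = Ω∈𝒮 , inj₂ (inj₁ (λ ω x → x))
      ; total = total
      }

  inner-representation : (μ : MeasureFn) → IsMeasure μ →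
    (𝒦 : Family Ω) (k : 𝒦 ⊑ 𝒮) →
    (∀ A (a : 𝒮 A) → Σ (Subset Ω) λ K → Σ (𝒦 K) λ κ →
        K ⊆ A × μ A a ≤ μ K (k K κ)) →
    ∀ A (a : 𝒮 A) → μ A a ≡ inner μ 𝒦 k A
  inner-representation μ isμ 𝒦 k witness A a with witness A a
  ... | K , κ , K⊆A , μA≤μK = ≤-antisym
          (≤-trans μA≤μK (⋁-upper _ (K , κ , K⊆A)))
          (⋁-least _ _ λ p → IsMeasure.μ-mono isμ _ _ _ a (proj₂ (proj₂ p)))

  outer-representation : (μ : MeasureFn) → IsMeasure μ →
    (𝒦 : Family Ω) (k : 𝒦 ⊑ 𝒮) →
    (∀ A (a : 𝒮 A) → Σ (Subset Ω) λ K → Σ (𝒦 K) λ κ →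
        A ⊆ K × μ K (k K κ) ≤ μ A a) →
    ∀ A (a : 𝒮 A) → μ A a ≡ outer μ 𝒦 k A
  outer-representation μ isμ 𝒦 k witness A a with witness A a
  ... | K , κ , A⊆K , μK≤μA = ≤-antisym
          (⋀-greatest _ _ λ p → IsMeasure.μ-mono isμ _ _ a _ (proj₂ (proj₂ p)))
          (≤-trans (⋀-lower _ (K , κ , A⊆K)) μK≤μA)

  module MinitiveLevels (μ : MeasureFn) (min : IsMinitive μ) where
    open IsMinitive min

    Above : Carrier → Family Ω
    Above t B = Σ (𝒮 B) λ b → t ≤ μ B b

    Above⊑𝒮 : ∀ t → Above t ⊑ 𝒮
    Above⊑𝒮 t B = proj₁

    C : Carrier → Subset Ω
    C t = proj₁ (⋂-closed (Above t) (Above⊑𝒮 t))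

    C∈𝒮 : ∀ t → 𝒮 (C t)
    C∈𝒮 t = proj₁ (proj₂ (⋂-closed (Above t) (Above⊑𝒮 t)))

    C≐ : ∀ t → C t ≐ ⋂ (Above t)
    C≐ t = proj₂ (proj₂ (⋂-closed (Above t) (Above⊑𝒮 t)))

    -- raising the level removes sets from the intersection
    C-mono : ∀ {s t} → s ≤ t → C s ⊆ C t
    C-mono {s} {t} s≤t ω x = proj₂ (C≐ t ω) λ B (b , t≤μB) →
      proj₁ (C≐ s ω) x B (b , ≤-trans s≤t t≤μB)

    -- A itself is intersected at level μ A
    C-below : ∀ A (a : 𝒮 A) → C (μ A a) ⊆ A
    C-below A a ω x = proj₁ (C≐ (μ A a) ω) x A (a , ≤-refl)

    -- minitivity: μ (C t) is the meet of values that are all ≥ t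
    C-measure : ∀ t → t ≤ μ (C t) (C∈𝒮 t)
    C-measure t = subst (t ≤_) (sym (μ-⋂ (Above t) (Above⊑𝒮 t) (C t) (C∈𝒮 t) (C≐ t)))
                        (⋀-greatest _ t λ p → proj₂ (proj₂ p))

  module MaxitiveLevels (μ : MeasureFn) (max : IsMaxitive μ) where
    open IsMaxitive max

    Below : Carrier → Family Ω
    Below t B = Σ (𝒮 B) λ b → μ B b ≤ t

    Below⊑𝒮 : ∀ t → Below t ⊑ 𝒮
    Below⊑𝒮 t B = proj₁

    C : Carrier → Subset Ω
    C t = proj₁ (⋃-closed (Below t) (Below⊑𝒮 t))

    C∈𝒮 : ∀ t → 𝒮 (C t)
    C∈𝒮 t = proj₁ (proj₂ (⋃-closed (Below t) (Below⊑𝒮 t)))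

    C≐ : ∀ t → C t ≐ ⋃ (Below t)
    C≐ t = proj₂ (proj₂ (⋃-closed (Below t) (Below⊑𝒮 t)))

    -- raising the level adds sets to the union
    C-mono : ∀ {s t} → s ≤ t → C s ⊆ C t
    C-mono {s} {t} s≤t ω x with proj₁ (C≐ s ω) x
    ... | B , (b , μB≤s) , Bω = proj₂ (C≐ t ω) (B , (b , ≤-trans μB≤s s≤t) , Bω)

    -- A itself is united at level μ A
    C-above : ∀ A (a : 𝒮 A) → A ⊆ C (μ A a)
    C-above A a ω x = proj₂ (C≐ (μ A a) ω) (A , (a , ≤-refl) , x)

    -- maxitivity: μ (C t) is the join of values that are all ≤ t
    C-measure : ∀ t → μ (C t) (C∈𝒮 t) ≤ t
    C-measure t = subst (_≤ t) (sym (μ-⋃ (Below t) (Below⊑𝒮 t) (C t) (C∈𝒮 t) (C≐ t)))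
                        (⋁-least _ t λ p → proj₂ (proj₂ p))

  minitive⇒lowerChain : (μ : MeasureFn) → IsMinitive μ → IsLowerChainMeasure μ
  minitive⇒lowerChain μ min = record
    { measure = IsMinitive.measure min
    ; 𝒦 = 𝒦 ; 𝒦⊆𝒮 = 𝒦⊆𝒮 ; chain = isChain
    ; μ≡inner = inner-representation μ (IsMinitive.measure min) 𝒦 𝒦⊆𝒮 λ A a →
        C (μ A a) , level∈𝒦 (μ A a) (C∈𝒮 (μ A a)) , C-below A a , C-measure (μ A a)
    }
    where
    open MinitiveLevels μ min
    open LevelChain C C-mono

  maxitive⇒upperChain : (μ : MeasureFn) → IsMaxitive μ → IsUpperChainMeasure μ
  maxitive⇒upperChain μ max = record
    { measure = IsMaxitive.measure max
    ; 𝒦 = 𝒦 ; 𝒦⊆𝒮 = 𝒦⊆𝒮 ; chain = isChain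
    ; μ≡outer = outer-representation μ (IsMaxitive.measure max) 𝒦 𝒦⊆𝒮 λ A a →
        C (μ A a) , level∈𝒦 (μ A a) (C∈𝒮 (μ A a)) , C-above A a , C-measure (μ A a)
    }
    where
    open MaxitiveLevels μ max
    open LevelChain C C-mono

proposition5p3 : (M : CompleteLinearLattice) (Ω : Set) → Ω →
    (𝒮 : Family Ω) (∅∈𝒮 : 𝒮 ∅) (Ω∈𝒮 : 𝒮 Full) →
    ((μ : Measures.MeasureFn M 𝒮 ∅∈𝒮 Ω∈𝒮) →
       Measures.IsMinitive M 𝒮 ∅∈𝒮 Ω∈𝒮 μ → Measures.IsLowerChainMeasure M 𝒮 ∅∈𝒮 Ω∈𝒮 μ)
    × ((μ : Measures.MeasureFn M 𝒮 ∅∈𝒮 Ω∈𝒮) →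
       Measures.IsMaxitive M 𝒮 ∅∈𝒮 Ω∈𝒮 μ → Measures.IsUpperChainMeasure M 𝒮 ∅∈𝒮 Ω∈𝒮 μ)
proposition5p3 M Ω _ 𝒮 ∅∈𝒮 Ω∈𝒮 =
  minitive⇒lowerChain M 𝒮 ∅∈𝒮 Ω∈𝒮 , maxitive⇒upperChain M 𝒮 ∅∈𝒮 Ω∈𝒮
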